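{- Let $M=(E,\mathcal{I})$ be a matroid and let $\alpha$ be defined as below. Then $$\alpha(x,y,s,M)=s^{|E|}\,T_M(x,y)$$ in $\mathbb{Q}[x,y,s]$, where $T_M(x,y)=\sum_{A\subseteq E}(x-1)^{r(E)-r(A)}(y-1)^{|A|-r(A)}$ is the Tutte polynomial of $M$.
   Context: $r$ denotes the rank function of the matroid. For $A\subseteq E$, $M|A$ is the restriction to $A$ and $M/A$ the contraction of $A$ (i.e. $(M^\star\setminus A)^\star$, $M^\star$ the dual matroid). $U_{0,1}$ is the one-element loop matroid, $U_{1,1}$ the one-element coloop matroid. The matroid Hopf algebra $H$ is the $\mathbb{Q}$-vector space with basis the isomorphism classes of finite matroids, product direct sum, coproduct $\Delta(M)=\sum_{A\subseteq E}M|A\otimes M/A$, counit $\epsilon(M)=1$ if $E=\emptyset$ and $0$ otherwise. For linear $f,g:H\to\mathbb{Q}[x,y,s]$, $(f\ast g)(M)=\sum_{A\subseteq E}f(M|A)g(M/A)$; for an infinitesimal character $\delta$ (i.e. $\delta(M_1\oplus M_2)=\delta(M_1)\epsilon(M_2)+\epsilon(M_1)\delta(M_2)$), $\exp_\ast(\delta)=\sum_{k\ge0}\delta^{\ast k}/k!$ with $\delta^{\ast 0}=\epsilon$. $\delta_{\mathrm{loop}}(M)=1$ if $M\cong U_{0,1}$, else $0$; $\delta_{\mathrm{coloop}}(M)=1$ if $M\cong U_{1,1}$, else $0$. Finally $\alpha(x,y,s,M)=\big(\exp_\ast s\{\delta_{\mathrm{coloop}}+(y-1)\delta_{\mathrm{loop}}\}\ast\exp_\ast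 s\{(x-1)\delta_{\mathrm{coloop}}+\delta_{\mathrm{loop}}\}\big)(M)$. -}

module Defs where

open import Data.Bool.Base using (Bool; true; false; if_then_else_; _∧_)
open import Data.Nat.Base as ℕ using (ℕ; zero; suc; _∸_; _!; _<_)
open import Data.Nat.Properties using (_≟_; _!≢0)
open import Data.Integer.Base using (+_)
open import Data.Rational.Base using (ℚ; 0ℚ; 1ℚ; _+_; _*_; _-_; _/_)
open import Data.Fin.Base using (Fin)
open import Data.Fin.Subset using (Subset; ⊥; ⊤; _∩_; _∪_; ∁; ∣_∣; _⊆_; _∈_; _∉_; ⁅_⁆; inside; outside)
open import Data.Fin.Subset.Properties using (_⊆?_)
open import Data.List.Base using (List; []; _∷_; map; filter; foldr; _++_)
open import Data.Vec.Base using (_∷_; [])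
open import Data.Product using (∃; _×_)
open import Relation.Binary.PropositionalEquality using (_≡_)
open import Relation.Nullary using (does)

Σℚ : {A : Set} → List A → (A → ℚ) → ℚ
Σℚ xs f = foldr (λ a acc → f a + acc) 0ℚ xs

infixr 8 _^ℚ_
_^ℚ_ : ℚ → ℕ → ℚ
q ^ℚ zero  = 1ℚ
q ^ℚ suc k = q * (q ^ℚ k)

subsets : (n : ℕ) → List (Subset n)
subsets zero    = [] ∷ []
subsets (suc n) = map (outside ∷_) (subsets n) ++ map (inside ∷_) (subsets n)

subsetsOf : {n : ℕ} → Subset n → List (Subset n)
subsetsOf {n} G = filter (λ A → A ⊆? G) (subsets n)

_∖_ : {n : ℕ} → Subset n → Subset n → Subset n
G ∖ A = G ∩ ∁ A

record Matroid (n : ℕ) : Set where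
  field
    indep      : Subset n → Bool
    indep-∅    : indep ⊥ ≡ true
    indep-⊆    : ∀ {A B} → A ⊆ B → indep B ≡ true → indep A ≡ true
    indep-exch : ∀ {A B} → indep A ≡ true → indep B ≡ true → ∣ A ∣ < ∣ B ∣ →
                 ∃ λ x → x ∈ B × x ∉ A × indep (A ∪ ⁅ x ⁆) ≡ true

open Matroid public

rank : {n : ℕ} → Matroid n → Subset n → ℕ
rank M A = foldr (λ B acc → if indep M B then ∣ B ∣ ℕ.⊔ acc else acc) 0 (subsetsOf A)

tutte : {n : ℕ} → Matroid n → ℚ → ℚ → ℚ
tutte {n} M x y =
  Σℚ (subsets n) λ A →
    ((x - 1ℚ) ^ℚ (rank M ⊤ ∸ rank M A)) * ((y - 1ℚ) ^ℚ (∣ A ∣ ∸ rank M A))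

-- Minors: a matroid on a ground set G ⊆ Fin n given by its rank function
-- (only its values on subsets of G matter).

record Minor (n : ℕ) : Set where
  constructor minor
  field
    ground : Subset n
    rk     : Subset n → ℕ

open Minor public

toMinor : {n : ℕ} → Matroid n → Minor n
toMinor M = minor ⊤ (rank M)

restrict : {n : ℕ} → Minor n → Subset n → Minor n
restrict N A = minor A (rk N)

delete : {n : ℕ} → Minor n → Subset n → Minor n
delete N A = restrict N (ground N ∖ A)

dual : {n : ℕ} → Minor n → Minor n
dual N = minor (ground N) (λ B → (∣ B ∣ ℕ.+ rk N (ground N ∖ B)) ∸ rk N (ground N))

contract : {n : ℕ} → Minor n → Subset n → Minor n
contract N A = dual (delete (dual N) A)

-- Linear maps H → ℚ (values at a point (x,y,s)), given on basis elements

Fun : ℕ → Set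
Fun n = Minor n → ℚ

_⋆_ : {n : ℕ} → Fun n → Fun n → Fun n
(f ⋆ g) N = Σℚ (subsetsOf (ground N)) λ A → f (restrict N A) * g (contract N A)

ε : {n : ℕ} → Fun n
ε N = if does (∣ ground N ∣ ≟ 0) then 1ℚ else 0ℚ

_⊕F_ : {n : ℕ} → Fun n → Fun n → Fun n
(f ⊕F g) N = f N + g N

_·F_ : {n : ℕ} → ℚ → Fun n → Fun n
(c ·F f) N = c * f N

_^⋆_ : {n : ℕ} → Fun n → ℕ → Fun n
δ ^⋆ zero  = ε
δ ^⋆ suc k = δ ⋆ (δ ^⋆ k)

-- exp_∗(δ) = Σ_k δ^{∗k}/k!  ; for an infinitesimal character δ and a
-- matroid on a subset of Fin n, all terms with k > n vanish, so the sum is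
-- truncated at k = n.
range : ℕ → List ℕ
range zero    = zero ∷ []
range (suc k) = suc k ∷ range k

expStar : {n : ℕ} → Fun n → Fun n
expStar {n} δ N = Σℚ (range n) λ k → (δ ^⋆ k) N * ((+ 1) / (k !)) {{k !≢0}}

-- The infinitesimal characters δ_loop, δ_coloop.
-- A one-element matroid is ≅ U_{0,1} iff its rank is 0, ≅ U_{1,1} iff rank 1.

δloop : {n : ℕ} → Fun n
δloop N = if does (∣ ground N ∣ ≟ 1) ∧ does (rk N (ground N) ≟ 0) then 1ℚ else 0ℚ

δcoloop : {n : ℕ} → Fun n
δcoloop N = if does (∣ ground N ∣ ≟ 1) ∧ does (rk N (ground N) ≟ 1) then 1ℚ else 0ℚ

α : {n : ℕ} → ℚ → ℚ → ℚ → Matroid n → ℚ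
α x y s M =
  (expStar (s ·F (δcoloop ⊕F ((y - 1ℚ) ·F δloop)))
   ⋆ expStar (s ·F (((x - 1ℚ) ·F δcoloop) ⊕F δloop))) (toMinor M)

module Submission where

-- Both exponents in α are of the form δ = p δ_coloop + q δ_loop (up to the
-- factor s): infinitesimal characters supported on one-element minors.  For
-- such δ and any minor N of M on g elements and of rank R, the convolution
-- power δ^{⋆k}(N) vanishes unless k = g, and δ^{⋆g}(N) = g! p^R q^(g-R):
-- expanding δ ⋆ δ^{⋆(g-1)} only the one-element restrictions N|{e} survive,
-- each is a coloop or a loop, and contracting it lowers (g, R) to (g-1, R-1)
-- resp. (g-1, R).  Hence exp_⋆ δ (N) = p^R q^(g-R).  Applied to M|A and M/A,
-- whose ranks are r(A) and r(E) - r(A), the A-summand of α becomes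
-- s^|E| (x-1)^(r(E)-r(A)) (y-1)^(|A|-r(A)), the A-summand of s^|E| T_M.

open import Defs
open import Data.Bool.Base using (true; false; if_then_else_)
open import Data.Bool.Properties using (∧-zeroʳ)
open import Data.Nat.Base as ℕ using (ℕ; zero; suc; _∸_; _≤_; _!; NonZero)
open import Data.Nat.Properties as ℕ
  using (_≟_; _!≢0; ≤-refl; ≤-trans; ≤-reflexive; n≤1⇒n≡0∨n≡1; suc-injective)
import Data.Integer.Base as ℤ
import Data.Integer.Solver as ℤ-Solver
open import Data.Rational.Base using (ℚ; 0ℚ; 1ℚ; _+_; _*_; _-_; _/_; toℚᵘ)
import Data.Rational.Properties as ℚ
import Data.Rational.Unnormalised.Base as ℚᵘ
import Data.Rational.Unnormalised.Properties as ℚᵘ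
import Data.Rational.Solver as ℚ-Solver
open import Data.Fin.Subset
  using (Subset; ⊥; ⊤; _∩_; _∪_; ∁; ∣_∣; _⊆_; inside; outside)
open import Data.Fin.Subset.Properties
  using ( _⊆?_; ⊆⊤; ⊥⊆; out⊆; in⊆in; drop-∷-⊆; p⊆q⇒∣p∣≤∣q∣; ∣p∣≤n; p∩q⊆p; ∣p∩q∣≤∣q∣
        ; x∈p∪q⁻; x∈p∩q⁻; p⊆p∪q; q⊆p∪q; x∈∁p⇒x∉p; ∪-assoc; ∪-identityˡ; ∣⊥∣≡0; ∣⊤∣≡n)
open import Data.Vec.Base using ([]; _∷_; here)
open import Data.List.Base using (List; []; _∷_; map; filter; foldr; _++_)
open import Data.List.Properties using (foldr-map; filter-all)
open import Data.List.Membership.Propositional using () renaming (_∈_ to _∈ₗ_)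
open import Data.List.Membership.Propositional.Properties using (∈-++⁺ˡ; ∈-++⁺ʳ; ∈-map⁺; ∈-filter⁺; ∈-filter⁻)
open import Data.List.Relation.Unary.All using (universal)
open import Data.List.Relation.Unary.Any using (here; there)
open import Data.Product using (∃; _,_; proj₁; proj₂)
open import Data.Sum using (_⊎_; inj₁; inj₂)
open import Function using (_∘_)
open import Relation.Binary.PropositionalEquality
open import Relation.Nullary using (Dec; does; yes; no; ¬_; contradiction; _×-dec_)
open import Relation.Unary using (Decidable)

private variable n : ℕ

∸-∸-cancel : ∀ {c u} v → c ≤ u → (v ∸ c) ∸ (u ∸ c) ≡ v ∸ u
∸-∸-cancel {c} {u} v c≤u = begin
  (v ∸ c) ∸ (u ∸ c)    ≡⟨ ℕ.∸-+-assoc v c (u ∸ c) ⟩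
  v ∸ (c ℕ.+ (u ∸ c))  ≡⟨ cong (v ∸_) (ℕ.m+[n∸m]≡n c≤u) ⟩
  v ∸ u                ∎
  where open ≡-Reasoning

-- The arithmetic behind the rank formula of a contraction: with m = |B|,
-- k = |G \ (C ∪ B)|, p = r(C ∪ B), q = r(C) and g = r(G), the rank of B
-- computed through two dualisations collapses to p - q.
contraction-arith : ∀ m k p q g → g ≤ k ℕ.+ p → g ≤ (m ℕ.+ k) ℕ.+ q →
  (m ℕ.+ ((k ℕ.+ p) ∸ g)) ∸ (((m ℕ.+ k) ℕ.+ q) ∸ g) ≡ p ∸ q
contraction-arith m k p q g g≤k+p g≤m+k+q = begin
  (m ℕ.+ ((k ℕ.+ p) ∸ g)) ∸ ((m ℕ.+ k ℕ.+ q) ∸ g)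
    ≡⟨ cong (_∸ ((m ℕ.+ k ℕ.+ q) ∸ g)) (sym (ℕ.+-∸-assoc m g≤k+p)) ⟩
  ((m ℕ.+ (k ℕ.+ p)) ∸ g) ∸ ((m ℕ.+ k ℕ.+ q) ∸ g)
    ≡⟨ cong (λ z → (z ∸ g) ∸ ((m ℕ.+ k ℕ.+ q) ∸ g)) (sym (ℕ.+-assoc m k p)) ⟩
  ((m ℕ.+ k ℕ.+ p) ∸ g) ∸ ((m ℕ.+ k ℕ.+ q) ∸ g)
    ≡⟨ ∸-∸-cancel (m ℕ.+ k ℕ.+ p) g≤m+k+q ⟩
  (m ℕ.+ k ℕ.+ p) ∸ (m ℕ.+ k ℕ.+ q)
    ≡⟨ ℕ.[m+n]∸[m+o]≡n∸o (m ℕ.+ k) p q ⟩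
  p ∸ q ∎
  where open ≡-Reasoning

^-+ : ∀ q m k → q ^ℚ (m ℕ.+ k) ≡ q ^ℚ m * q ^ℚ k
^-+ q zero    k = sym (ℚ.*-identityˡ (q ^ℚ k))
^-+ q (suc m) k = trans (cong (q *_) (^-+ q m k)) (sym (ℚ.*-assoc q (q ^ℚ m) (q ^ℚ k)))

1^ : ∀ m → 1ℚ ^ℚ m ≡ 1ℚ
1^ zero    = refl
1^ (suc m) = cong (1ℚ *_) (1^ m)

*-^ : ∀ p q m → (p * q) ^ℚ m ≡ p ^ℚ m * q ^ℚ m
*-^ p q zero    = refl
*-^ p q (suc m) = trans (cong ((p * q) *_) (*-^ p q m))
  (solve 4 (λ p q a b → (p :* q) :* (a :* b) := (p :* a) :* (q :* b)) refl p q (p ^ℚ m) (q ^ℚ m))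
  where open ℚ-Solver.+-*-Solver

fromℕ : ℕ → ℚ
fromℕ zero    = 0ℚ
fromℕ (suc m) = 1ℚ + fromℕ m

fromℕ-+ : ∀ m k → fromℕ (m ℕ.+ k) ≡ fromℕ m + fromℕ k
fromℕ-+ zero    k = sym (ℚ.+-identityˡ (fromℕ k))
fromℕ-+ (suc m) k = trans (cong (1ℚ +_) (fromℕ-+ m k)) (sym (ℚ.+-assoc 1ℚ (fromℕ m) (fromℕ k)))

fromℕ-* : ∀ m k → fromℕ (m ℕ.* k) ≡ fromℕ m * fromℕ k
fromℕ-* zero    k = sym (ℚ.*-zeroˡ (fromℕ k))
fromℕ-* (suc m) k = begin
  fromℕ (k ℕ.+ m ℕ.* k)          ≡⟨ fromℕ-+ k (m ℕ.* k) ⟩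
  fromℕ k + fromℕ (m ℕ.* k)      ≡⟨ cong (fromℕ k +_) (fromℕ-* m k) ⟩
  fromℕ k + fromℕ m * fromℕ k    ≡⟨ solve 2 (λ a b → b :+ a :* b := (con 1ℚ :+ a) :* b) refl (fromℕ m) (fromℕ k) ⟩
  (1ℚ + fromℕ m) * fromℕ k       ∎
  where open ≡-Reasoning; open ℚ-Solver.+-*-Solver

fromℕ-toℚᵘ : ∀ m → toℚᵘ (fromℕ m) ℚᵘ.≃ ℚᵘ.mkℚᵘ (ℤ.+ m) 0
fromℕ-toℚᵘ zero    = ℚᵘ.≃-refl
fromℕ-toℚᵘ (suc m) = ℚᵘ.≃-trans (ℚ.toℚᵘ-homo-+ 1ℚ (fromℕ m))
  (ℚᵘ.≃-trans (ℚᵘ.+-congʳ ℚᵘ.1ℚᵘ (fromℕ-toℚᵘ m))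
              (ℚᵘ.*≡* (solve 1 (λ a → (con (ℤ.+ 1) :* con (ℤ.+ 1) :+ a :* con (ℤ.+ 1)) :* con (ℤ.+ 1)
                                       := (con (ℤ.+ 1) :+ a) :* (con (ℤ.+ 1) :* con (ℤ.+ 1))) refl (ℤ.+ m))))
  where open ℤ-Solver.+-*-Solver

fromℕ-inverse : ∀ m .{{_ : NonZero m}} → fromℕ m * ((ℤ.+ 1) / m) ≡ 1ℚ
fromℕ-inverse (suc j) = ℚ.toℚᵘ-injective
  (ℚᵘ.≃-trans (ℚ.toℚᵘ-homo-* (fromℕ (suc j)) ((ℤ.+ 1) / suc j))
  (ℚᵘ.≃-trans (ℚᵘ.*-cong (fromℕ-toℚᵘ (suc j)) (ℚ.toℚᵘ-fromℚᵘ (ℚᵘ.mkℚᵘ (ℤ.+ 1) j)))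
              (ℚᵘ.*-inverseʳ (ℚᵘ.mkℚᵘ (ℤ.+ suc j) 0))))

Σ-++ : {A : Set} (xs ys : List A) (f : A → ℚ) → Σℚ (xs ++ ys) f ≡ Σℚ xs f + Σℚ ys f
Σ-++ []       ys f = sym (ℚ.+-identityˡ (Σℚ ys f))
Σ-++ (x ∷ xs) ys f = trans (cong (f x +_) (Σ-++ xs ys f)) (sym (ℚ.+-assoc (f x) (Σℚ xs f) (Σℚ ys f)))

Σ-map : {A B : Set} (g : A → B) (xs : List A) (f : B → ℚ) → Σℚ (map g xs) f ≡ Σℚ xs (f ∘ g)
Σ-map g xs f = foldr-map (λ b acc → f b + acc) g 0ℚ xs

Σ-cong : {A : Set} (xs : List A) {f g : A → ℚ} → (∀ a → f a ≡ g a) → Σℚ xs f ≡ Σℚ xs g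
Σ-cong []       f≗g = refl
Σ-cong (x ∷ xs) f≗g = cong₂ _+_ (f≗g x) (Σ-cong xs f≗g)

Σ-zero : {A : Set} (xs : List A) {f : A → ℚ} → (∀ a → f a ≡ 0ℚ) → Σℚ xs f ≡ 0ℚ
Σ-zero []       f≗0 = refl
Σ-zero (x ∷ xs) f≗0 = cong₂ _+_ (f≗0 x) (Σ-zero xs f≗0)

Σ-*ˡ : {A : Set} (c : ℚ) (xs : List A) (f : A → ℚ) → c * Σℚ xs f ≡ Σℚ xs (λ a → c * f a)
Σ-*ˡ c []       f = ℚ.*-zeroʳ c
Σ-*ˡ c (x ∷ xs) f = trans (ℚ.*-distribˡ-+ c (f x) (Σℚ xs f)) (cong (c * f x +_) (Σ-*ˡ c xs f))

Σ-filter : {A : Set} {P : A → Set} (P? : Decidable P) (xs : List A) (f : A → ℚ) →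
  Σℚ (filter P? xs) f ≡ Σℚ xs (λ a → if does (P? a) then f a else 0ℚ)
Σ-filter P? []       f = refl
Σ-filter P? (x ∷ xs) f with does (P? x)
... | true  = cong (f x +_) (Σ-filter P? xs f)
... | false = trans (Σ-filter P? xs f) (sym (ℚ.+-identityˡ _))

Σ-range-zero : ∀ m (f : ℕ → ℚ) → (∀ k → k ≤ m → f k ≡ 0ℚ) → Σℚ (range m) f ≡ 0ℚ
Σ-range-zero zero    f f≗0 = cong (_+ 0ℚ) (f≗0 0 ℕ.z≤n)
Σ-range-zero (suc m) f f≗0 =
  cong₂ _+_ (f≗0 (suc m) ≤-refl) (Σ-range-zero m f (λ k k≤m → f≗0 k (ℕ.m≤n⇒m≤1+n k≤m)))

Σ-range-select : ∀ m j (f : ℕ → ℚ) → j ≤ m → (∀ k → k ≢ j → f k ≡ 0ℚ) → Σℚ (range m) f ≡ f j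
Σ-range-select zero    zero f _   f≗0 = ℚ.+-identityʳ (f 0)
Σ-range-select (suc m) j    f j≤m f≗0 with j ≟ suc m
... | yes refl = trans (cong (f (suc m) +_) (Σ-range-zero m f λ k k≤m → f≗0 k (ℕ.<⇒≢ (ℕ.s≤s k≤m))))
                       (ℚ.+-identityʳ (f (suc m)))
... | no j≢1+m = trans (cong₂ _+_ (f≗0 (suc m) (j≢1+m ∘ sym))
                                  (Σ-range-select m j f (ℕ.≤-pred (ℕ.≤∧≢⇒< j≤m j≢1+m)) f≗0))
                       (ℚ.+-identityˡ (f j))

card-split : (X Y : Subset n) → ∣ X ∣ ≡ ∣ X ∩ Y ∣ ℕ.+ ∣ X ∖ Y ∣
card-split []            []            = refl
card-split (outside ∷ X) (_       ∷ Y) = card-split X Y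
card-split (inside  ∷ X) (inside  ∷ Y) = cong suc (card-split X Y)
card-split (inside  ∷ X) (outside ∷ Y) = trans (cong suc (card-split X Y)) (sym (ℕ.+-suc _ _))

∩-⊆ : {G D : Subset n} → D ⊆ G → G ∩ D ≡ D
∩-⊆ {G = []}          {D = []}          _   = refl
∩-⊆ {G = g ∷ G}       {D = outside ∷ D} D⊆G = cong₂ _∷_ (∧-zeroʳ g) (∩-⊆ (drop-∷-⊆ D⊆G))
∩-⊆ {G = inside ∷ G}  {D = inside ∷ D}  D⊆G = cong (inside ∷_) (∩-⊆ (drop-∷-⊆ D⊆G))
∩-⊆ {G = outside ∷ G} {D = inside ∷ D}  D⊆G with D⊆G here
... | ()

card-∖ : {G D : Subset n} → D ⊆ G → ∣ G ∣ ≡ ∣ D ∣ ℕ.+ ∣ G ∖ D ∣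
card-∖ {G = G} {D = D} D⊆G = trans (card-split G D) (cong (ℕ._+ ∣ G ∖ D ∣) (cong ∣_∣ (∩-⊆ D⊆G)))

card-∖-singleton : {G A : Subset n} → A ⊆ G → ∣ A ∣ ≡ 1 → ∣ G ∣ ≡ suc ∣ G ∖ A ∣
card-∖-singleton {G = G} {A = A} A⊆G ∣A∣≡1 = trans (card-∖ A⊆G) (cong (ℕ._+ ∣ G ∖ A ∣) ∣A∣≡1)

∖-∖ : {G D : Subset n} → D ⊆ G → G ∖ (G ∖ D) ≡ D
∖-∖ {G = []}          {D = []}          _   = refl
∖-∖ {G = outside ∷ G} {D = outside ∷ D} D⊆G = cong (outside ∷_) (∖-∖ (drop-∷-⊆ D⊆G))
∖-∖ {G = inside ∷ G}  {D = outside ∷ D} D⊆G = cong (outside ∷_) (∖-∖ (drop-∷-⊆ D⊆G))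
∖-∖ {G = inside ∷ G}  {D = inside ∷ D}  D⊆G = cong (inside ∷_) (∖-∖ (drop-∷-⊆ D⊆G))
∖-∖ {G = outside ∷ G} {D = inside ∷ D}  D⊆G with D⊆G here
... | ()

∪-∖ : {G D : Subset n} → D ⊆ G → D ∪ (G ∖ D) ≡ G
∪-∖ {G = []}          {D = []}          _   = refl
∪-∖ {G = outside ∷ G} {D = outside ∷ D} D⊆G = cong (outside ∷_) (∪-∖ (drop-∷-⊆ D⊆G))
∪-∖ {G = inside ∷ G}  {D = outside ∷ D} D⊆G = cong (inside ∷_) (∪-∖ (drop-∷-⊆ D⊆G))
∪-∖ {G = inside ∷ G}  {D = inside ∷ D}  D⊆G = cong (inside ∷_) (∪-∖ (drop-∷-⊆ D⊆G))
∪-∖ {G = outside ∷ G} {D = inside ∷ D}  D⊆G with D⊆G here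
... | ()

∖-∖-∪ : (G C B : Subset n) → (G ∖ C) ∖ B ≡ G ∖ (C ∪ B)
∖-∖-∪ []            []            []      = refl
∖-∖-∪ (outside ∷ G) (_       ∷ C) (_ ∷ B) = cong (outside ∷_) (∖-∖-∪ G C B)
∖-∖-∪ (inside  ∷ G) (inside  ∷ C) (_ ∷ B) = cong (outside ∷_) (∖-∖-∪ G C B)
∖-∖-∪ (inside  ∷ G) (outside ∷ C) (_ ∷ B) = cong (_ ∷_) (∖-∖-∪ G C B)

∪-monoʳ : (A : Subset n) {X Y : Subset n} → X ⊆ Y → A ∪ X ⊆ A ∪ Y
∪-monoʳ A {X} {Y} X⊆Y x∈A∪X with x∈p∪q⁻ A X x∈A∪X
... | inj₁ x∈A = p⊆p∪q Y x∈A
... | inj₂ x∈X = q⊆p∪q A Y (X⊆Y x∈X)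

∪-⊆ : {G C B : Subset n} → C ⊆ G → B ⊆ G ∖ C → C ∪ B ⊆ G
∪-⊆ {G = G} {C = C} {B = B} C⊆G B⊆G∖C x∈C∪B with x∈p∪q⁻ C B x∈C∪B
... | inj₁ x∈C = C⊆G x∈C
... | inj₂ x∈B = p∩q⊆p G (∁ C) (B⊆G∖C x∈B)

∈-subsets : (B : Subset n) → B ∈ₗ subsets n
∈-subsets []            = here refl
∈-subsets (outside ∷ B) = ∈-++⁺ˡ (∈-map⁺ (outside ∷_) (∈-subsets B))
∈-subsets (inside  ∷ B) = ∈-++⁺ʳ _ (∈-map⁺ (inside ∷_) (∈-subsets B))

-- Σ_{A ⊆ G} F A, written as a sum over all subsets with an indicator; this
-- form can be decomposed along the first coordinate.
ΣS : Subset n → (Subset n → ℚ) → ℚ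
ΣS {n} G F = Σℚ (subsets n) (λ A → if does (A ⊆? G) then F A else 0ℚ)

Σ-subsetsOf : (G : Subset n) (F : Subset n → ℚ) → Σℚ (subsetsOf G) F ≡ ΣS G F
Σ-subsetsOf {n} G F = Σ-filter (_⊆? G) (subsets n) F

ΣS-first : ∀ g (G : Subset n) (F : Subset (suc n) → ℚ) → ℚ
ΣS-first {n} g G F = Σℚ (subsets n) (λ A → if does ((inside ∷ A) ⊆? (g ∷ G)) then F (inside ∷ A) else 0ℚ)

ΣS-first-outside : (G : Subset n) (F : Subset (suc n) → ℚ) → ΣS-first outside G F ≡ 0ℚ
ΣS-first-outside {n} G F = Σ-zero (subsets n) (λ _ → refl)

ΣS-∷ : ∀ g (G : Subset n) (F : Subset (suc n) → ℚ) →
  ΣS (g ∷ G) F ≡ ΣS G (F ∘ (outside ∷_)) + ΣS-first g G F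
ΣS-∷ {n} g G F = trans (Σ-++ (map (outside ∷_) (subsets n)) (map (inside ∷_) (subsets n)) indicator)
  (cong₂ _+_ (Σ-map (outside ∷_) (subsets n) indicator) (Σ-map (inside ∷_) (subsets n) indicator))
  where
  indicator : Subset (suc n) → ℚ
  indicator A = if does (A ⊆? (g ∷ G)) then F A else 0ℚ

Σ-supported-on-∅ : (G : Subset n) (F : Subset n → ℚ) →
  (∀ A → A ⊆ G → ∣ A ∣ ≢ 0 → F A ≡ 0ℚ) → ΣS G F ≡ F ⊥
Σ-supported-on-∅ []      F F-vanishes = ℚ.+-identityʳ (F [])
Σ-supported-on-∅ (g ∷ G) F F-vanishes = begin
  ΣS (g ∷ G) F                                 ≡⟨ ΣS-∷ g G F ⟩
  ΣS G (F ∘ (outside ∷_)) + ΣS-first g G F     ≡⟨ cong₂ _+_ empty-part (Σ-zero (subsets _) nonempty-part) ⟩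
  F ⊥ + 0ℚ                                     ≡⟨ ℚ.+-identityʳ (F ⊥) ⟩
  F ⊥                                          ∎
  where
  open ≡-Reasoning
  empty-part : ΣS G (F ∘ (outside ∷_)) ≡ F ⊥
  empty-part = Σ-supported-on-∅ G (F ∘ (outside ∷_)) λ A A⊆G → F-vanishes _ (out⊆ A⊆G)
  nonempty-part : ∀ A → (if does ((inside ∷ A) ⊆? (g ∷ G)) then F (inside ∷ A) else 0ℚ) ≡ 0ℚ
  nonempty-part A with (inside ∷ A) ⊆? (g ∷ G)
  ... | yes A⊆G = F-vanishes _ A⊆G (λ ())
  ... | no  _   = refl

Σ-supported-on-singletons : (G : Subset n) (F : Subset n → ℚ) (c : ℚ) →
  (∀ A → A ⊆ G → ∣ A ∣ ≢ 1 → F A ≡ 0ℚ) → (∀ A → A ⊆ G → ∣ A ∣ ≡ 1 → F A ≡ c) →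
  ΣS G F ≡ fromℕ ∣ G ∣ * c
Σ-supported-on-singletons [] F c F-vanishes _ =
  trans (ℚ.+-identityʳ (F [])) (trans (F-vanishes [] (λ A → A) (λ ())) (sym (ℚ.*-zeroˡ c)))
Σ-supported-on-singletons (outside ∷ G) F c F-vanishes F-const = begin
  ΣS (outside ∷ G) F                  ≡⟨ ΣS-∷ outside G F ⟩
  ΣS G (F ∘ (outside ∷_)) + ΣS-first outside G F
                                      ≡⟨ cong₂ _+_ (Σ-supported-on-singletons G (F ∘ (outside ∷_)) c
                                                       (λ A A⊆G → F-vanishes _ (out⊆ A⊆G))
                                                       (λ A A⊆G → F-const _ (out⊆ A⊆G)))
                                                    (ΣS-first-outside G F) ⟩
  fromℕ ∣ G ∣ * c + 0ℚ                ≡⟨ ℚ.+-identityʳ _ ⟩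
  fromℕ ∣ G ∣ * c                     ∎
  where open ≡-Reasoning
Σ-supported-on-singletons {suc n} (inside ∷ G) F c F-vanishes F-const = begin
  ΣS (inside ∷ G) F                                   ≡⟨ ΣS-∷ inside G F ⟩
  ΣS G (F ∘ (outside ∷_)) + ΣS G (F ∘ (inside ∷_))    ≡⟨ cong₂ _+_ without-first with-first ⟩
  fromℕ ∣ G ∣ * c + c                                 ≡⟨ solve 2 (λ g c → g :* c :+ c := (con 1ℚ :+ g) :* c) refl (fromℕ ∣ G ∣) c ⟩
  (1ℚ + fromℕ ∣ G ∣) * c                              ∎
  where
  open ≡-Reasoning
  open ℚ-Solver.+-*-Solver
  without-first : ΣS G (F ∘ (outside ∷_)) ≡ fromℕ ∣ G ∣ * c
  without-first = Σ-supported-on-singletons G (F ∘ (outside ∷_)) c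
    (λ A A⊆G → F-vanishes _ (out⊆ A⊆G)) (λ A A⊆G → F-const _ (out⊆ A⊆G))
  with-first : ΣS G (F ∘ (inside ∷_)) ≡ c
  with-first = trans (Σ-supported-on-∅ G (F ∘ (inside ∷_)) λ A A⊆G ∣A∣≢0 → F-vanishes _ (in⊆in A⊆G) (∣A∣≢0 ∘ suc-injective))
                     (F-const (inside ∷ ⊥) (in⊆in ⊥⊆) (cong suc (∣⊥∣≡0 n)))

module _ (M : Matroid n) where

  private
    step : Subset n → ℕ → ℕ
    step B acc = if indep M B then ∣ B ∣ ℕ.⊔ acc else acc

    fold-≥ : ∀ {B} xs → B ∈ₗ xs → indep M B ≡ true → ∣ B ∣ ≤ foldr step 0 xs
    fold-≥ {B} (C ∷ xs) (here refl) B-indep rewrite B-indep = ℕ.m≤m⊔n ∣ B ∣ _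
    fold-≥ (C ∷ xs) (there B∈xs) B-indep with indep M C
    ... | true  = ≤-trans (fold-≥ xs B∈xs B-indep) (ℕ.m≤n⊔m ∣ C ∣ _)
    ... | false = fold-≥ xs B∈xs B-indep

    fold-≤ : ∀ {m} xs → (∀ B → B ∈ₗ xs → indep M B ≡ true → ∣ B ∣ ≤ m) → foldr step 0 xs ≤ m
    fold-≤ []       bound = ℕ.z≤n
    fold-≤ (C ∷ xs) bound with indep M C in C-indep
    ... | true  = ℕ.⊔-lub (bound C (here refl) C-indep) (fold-≤ xs (λ B → bound B ∘ there))
    ... | false = fold-≤ xs (λ B → bound B ∘ there)

  rank-≥ : ∀ {A B} → B ⊆ A → indep M B ≡ true → ∣ B ∣ ≤ rank M A
  rank-≥ {A} {B} B⊆A = fold-≥ (subsetsOf A) (∈-filter⁺ (_⊆? A) (∈-subsets B) B⊆A)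

  rank-≤ : ∀ {A} m → (∀ B → B ⊆ A → indep M B ≡ true → ∣ B ∣ ≤ m) → rank M A ≤ m
  rank-≤ {A} m bound = fold-≤ (subsetsOf A) λ B B∈ → bound B (proj₂ (∈-filter⁻ (_⊆? A) {xs = subsets n} B∈))

  rank-mono : ∀ {A A′} → A ⊆ A′ → rank M A ≤ rank M A′
  rank-mono A⊆A′ = rank-≤ _ λ B B⊆A → rank-≥ (A⊆A′ ∘ B⊆A)

  rank-⊥ : rank M ⊥ ≡ 0
  rank-⊥ = ℕ.n≤0⇒n≡0 (rank-≤ 0 λ B B⊆⊥ _ → ≤-trans (p⊆q⇒∣p∣≤∣q∣ B⊆⊥) (≤-reflexive (∣⊥∣≡0 n)))

  rank-∪-≤ : ∀ X Z → rank M (X ∪ Z) ≤ rank M X ℕ.+ ∣ Z ∣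
  rank-∪-≤ X Z = rank-≤ _ λ B B⊆X∪Z B-indep → begin
    ∣ B ∣                              ≡⟨ card-split B Z ⟩
    ∣ B ∩ Z ∣ ℕ.+ ∣ B ∖ Z ∣            ≤⟨ ℕ.+-mono-≤ (∣p∩q∣≤∣q∣ B Z)
                                                   (rank-≥ (B∖Z⊆X B⊆X∪Z) (indep-⊆ M (p∩q⊆p B (∁ Z)) B-indep)) ⟩
    ∣ Z ∣ ℕ.+ rank M X                 ≡⟨ ℕ.+-comm ∣ Z ∣ (rank M X) ⟩
    rank M X ℕ.+ ∣ Z ∣                 ∎
    where
    open ℕ.≤-Reasoning
    B∖Z⊆X : ∀ {B} → B ⊆ X ∪ Z → B ∖ Z ⊆ X
    B∖Z⊆X {B} B⊆X∪Z x∈B∖Z with x∈p∩q⁻ B (∁ Z) x∈B∖Z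
    ... | x∈B , x∈∁Z with x∈p∪q⁻ X Z (B⊆X∪Z x∈B)
    ... | inj₁ x∈X = x∈X
    ... | inj₂ x∈Z = contradiction x∈Z (x∈∁p⇒x∉p x∈∁Z)

module _ (M : Matroid n) where

  -- N is a minor of M when, on its ground set, its rank function is that of a
  -- contraction M / A, namely B ↦ r(A ∪ B) - r(A).  Restrictions M|A and
  -- contractions M/A, and all their iterated minors, are of this form.
  MinorOf : Minor n → Set
  MinorOf N = ∃ λ A → ∀ B → B ⊆ ground N → rk N B ≡ rank M (A ∪ B) ∸ rank M A

  toMinor-minor : MinorOf (toMinor M)
  toMinor-minor = ⊥ , λ B _ → sym (cong₂ _∸_ (cong (rank M) (∪-identityˡ B)) (rank-⊥ M))

  restrict-minor : ∀ {N A} → MinorOf N → A ⊆ ground N → MinorOf (restrict N A)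
  restrict-minor (A , rk≡) A′⊆G = A , λ B B⊆A′ → rk≡ B (A′⊆G ∘ B⊆A′)

  minor-rank≤card : ∀ {N B} → MinorOf N → B ⊆ ground N → rk N B ≤ ∣ B ∣
  minor-rank≤card {B = B} (A , rk≡) B⊆G rewrite rk≡ B B⊆G =
    ℕ.m≤n+o⇒m∸n≤o (rank M (A ∪ B)) (rank M A) (rank-∪-≤ M A B)

  minor-mono : ∀ {N X Y} → MinorOf N → X ⊆ Y → Y ⊆ ground N → rk N X ≤ rk N Y
  minor-mono {X = X} {Y} (A , rk≡) X⊆Y Y⊆G rewrite rk≡ X (Y⊆G ∘ X⊆Y) | rk≡ Y Y⊆G =
    ℕ.∸-monoˡ-≤ (rank M A) (rank-mono M (∪-monoʳ A X⊆Y))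

  minor-complement : ∀ {N D} → MinorOf N → D ⊆ ground N →
    rk N (ground N) ≤ ∣ ground N ∖ D ∣ ℕ.+ rk N D
  minor-complement {N} {D} (A , rk≡) D⊆G = begin
    rk N G                                             ≡⟨ rk≡ G (λ x∈G → x∈G) ⟩
    rank M (A ∪ G) ∸ a                                 ≡⟨ cong (λ X → rank M X ∸ a) A∪G≡ ⟩
    rank M ((A ∪ D) ∪ (G ∖ D)) ∸ a                     ≤⟨ ℕ.∸-monoˡ-≤ a (rank-∪-≤ M (A ∪ D) (G ∖ D)) ⟩
    (rank M (A ∪ D) ℕ.+ ∣ G ∖ D ∣) ∸ a                 ≡⟨ ℕ.+-∸-comm ∣ G ∖ D ∣ (rank-mono M (p⊆p∪q D)) ⟩
    (rank M (A ∪ D) ∸ a) ℕ.+ ∣ G ∖ D ∣                 ≡⟨ cong (ℕ._+ ∣ G ∖ D ∣) (sym (rk≡ D D⊆G)) ⟩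
    rk N D ℕ.+ ∣ G ∖ D ∣                               ≡⟨ ℕ.+-comm (rk N D) ∣ G ∖ D ∣ ⟩
    ∣ G ∖ D ∣ ℕ.+ rk N D                               ∎
    where
    open ℕ.≤-Reasoning
    G : Subset n
    G = ground N
    a : ℕ
    a = rank M A
    A∪G≡ : A ∪ G ≡ (A ∪ D) ∪ (G ∖ D)
    A∪G≡ = sym (trans (∪-assoc A D (G ∖ D)) (cong (A ∪_) (∪-∖ D⊆G)))

  contract-rank : ∀ {N C B} → MinorOf N → C ⊆ ground N → B ⊆ ground N ∖ C →
    rk (contract N C) B ≡ rk N (C ∪ B) ∸ rk N C
  contract-rank {N} {C} {B} N-minor C⊆G B⊆G∖C = begin
    rk (contract N C) B
      ≡⟨⟩
    (∣ B ∣ ℕ.+ ((k ℕ.+ rk N (G ∖ ((G ∖ C) ∖ B))) ∸ g)) ∸ ((∣ G ∖ C ∣ ℕ.+ rk N (G ∖ (G ∖ C))) ∸ g)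
      ≡⟨ cong₂ (λ X Y → (∣ B ∣ ℕ.+ ((k ℕ.+ rk N X) ∸ g)) ∸ ((Y ℕ.+ rk N (G ∖ (G ∖ C))) ∸ g))
               G∖[G∖C∖B]≡C∪B (card-∖ B⊆G∖C) ⟩
    (∣ B ∣ ℕ.+ ((k ℕ.+ rk N (C ∪ B)) ∸ g)) ∸ (((∣ B ∣ ℕ.+ k) ℕ.+ rk N (G ∖ (G ∖ C))) ∸ g)
      ≡⟨ cong (λ X → (∣ B ∣ ℕ.+ ((k ℕ.+ rk N (C ∪ B)) ∸ g)) ∸ (((∣ B ∣ ℕ.+ k) ℕ.+ rk N X) ∸ g)) (∖-∖ C⊆G) ⟩
    (∣ B ∣ ℕ.+ ((k ℕ.+ rk N (C ∪ B)) ∸ g)) ∸ (((∣ B ∣ ℕ.+ k) ℕ.+ rk N C) ∸ g)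
      ≡⟨ contraction-arith ∣ B ∣ k (rk N (C ∪ B)) (rk N C) g g≤k+r[C∪B] g≤m+k+r[C] ⟩
    rk N (C ∪ B) ∸ rk N C ∎
    where
    open ≡-Reasoning
    G : Subset n
    G = ground N
    g k : ℕ
    g = rk N G
    k = ∣ (G ∖ C) ∖ B ∣
    C∪B⊆G : C ∪ B ⊆ G
    C∪B⊆G = ∪-⊆ C⊆G B⊆G∖C
    G∖[G∖C∖B]≡C∪B : G ∖ ((G ∖ C) ∖ B) ≡ C ∪ B
    G∖[G∖C∖B]≡C∪B = trans (cong (G ∖_) (∖-∖-∪ G C B)) (∖-∖ C∪B⊆G)
    g≤k+r[C∪B] : g ≤ k ℕ.+ rk N (C ∪ B)
    g≤k+r[C∪B] = subst (λ X → g ≤ ∣ X ∣ ℕ.+ rk N (C ∪ B)) (sym (∖-∖-∪ G C B)) (minor-complement N-minor C∪B⊆G)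
    g≤m+k+r[C] : g ≤ (∣ B ∣ ℕ.+ k) ℕ.+ rk N C
    g≤m+k+r[C] = subst (λ x → g ≤ x ℕ.+ rk N C) (card-∖ B⊆G∖C) (minor-complement N-minor C⊆G)

  contract-minor : ∀ {N C} → MinorOf N → C ⊆ ground N → MinorOf (contract N C)
  contract-minor {N} {C} N-minor@(A , rk≡) C⊆G = A ∪ C , λ B B⊆G∖C → begin
    rk (contract N C) B                                              ≡⟨ contract-rank N-minor C⊆G B⊆G∖C ⟩
    rk N (C ∪ B) ∸ rk N C                                            ≡⟨ cong₂ _∸_ (rk≡ (C ∪ B) (∪-⊆ C⊆G B⊆G∖C)) (rk≡ C C⊆G) ⟩
    (rank M (A ∪ (C ∪ B)) ∸ rank M A) ∸ (rank M (A ∪ C) ∸ rank M A)  ≡⟨ ∸-∸-cancel (rank M (A ∪ (C ∪ B))) (rank-mono M (p⊆p∪q C)) ⟩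
    rank M (A ∪ (C ∪ B)) ∸ rank M (A ∪ C)                            ≡⟨ cong (λ X → rank M X ∸ rank M (A ∪ C)) (sym (∪-assoc A C B)) ⟩
    rank M ((A ∪ C) ∪ B) ∸ rank M (A ∪ C)                            ∎
    where open ≡-Reasoning

  contract-rank-ground : ∀ {N C} → MinorOf N → C ⊆ ground N →
    rk (contract N C) (ground N ∖ C) ≡ rk N (ground N) ∸ rk N C
  contract-rank-ground {N} {C} N-minor C⊆G =
    trans (contract-rank N-minor C⊆G (λ x∈ → x∈)) (cong (λ X → rk N X ∸ rk N C) (∪-∖ C⊆G))

if-yes : {A P : Set} (P? : Dec P) {a b : A} → P → (if does P? then a else b) ≡ a
if-yes (yes _) _ = refl
if-yes (no ¬P) P = contradiction P ¬P

if-no : {A P : Set} (P? : Dec P) {a b : A} → ¬ P → (if does P? then a else b) ≡ b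
if-no (yes P) ¬P = contradiction P ¬P
if-no (no _)  _  = refl

one-element : (N : Minor n) → Dec (∣ ground N ∣ ≡ 1)
one-element N = ∣ ground N ∣ ≟ 1

rank-is : (N : Minor n) (j : ℕ) → Dec (rk N (ground N) ≡ j)
rank-is N j = rk N (ground N) ≟ j

record SingletonCharacter {n : ℕ} (δ : Fun n) (p q : ℚ) : Set where
  field
    off-singletons : ∀ N → ∣ ground N ∣ ≢ 1 → δ N ≡ 0ℚ
    on-coloop      : ∀ N → ∣ ground N ∣ ≡ 1 → rk N (ground N) ≡ 1 → δ N ≡ p
    on-loop        : ∀ N → ∣ ground N ∣ ≡ 1 → rk N (ground N) ≡ 0 → δ N ≡ q

-- The monomial p^R q^(g - R) of a rank-R matroid on g elements, and the
-- weight of a minor; the weight is what exp_⋆ δ computes.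
monomial : ℚ → ℚ → ℕ → ℕ → ℚ
monomial p q R g = p ^ℚ R * q ^ℚ (g ∸ R)

weight : ℚ → ℚ → Minor n → ℚ
weight p q N = monomial p q (rk N (ground N)) ∣ ground N ∣

monomial-coloop : ∀ p q R g → p * monomial p q R g ≡ monomial p q (suc R) (suc g)
monomial-coloop p q R g = sym (ℚ.*-assoc p (p ^ℚ R) (q ^ℚ (g ∸ R)))

monomial-loop : ∀ p q {R g} → R ≤ g → q * monomial p q R g ≡ monomial p q R (suc g)
monomial-loop p q {R} {g} R≤g rewrite ℕ.+-∸-assoc 1 R≤g =
  solve 3 (λ q a b → q :* (a :* b) := a :* (q :* b)) refl q (p ^ℚ R) (q ^ℚ (g ∸ R))
  where open ℚ-Solver.+-*-Solver

monomial-scale : ∀ s u v {R g} → R ≤ g → monomial (s * u) (s * v) R g ≡ s ^ℚ g * monomial u v R g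
monomial-scale s u v {R} {g} R≤g = begin
  (s * u) ^ℚ R * (s * v) ^ℚ (g ∸ R)
    ≡⟨ cong₂ _*_ (*-^ s u R) (*-^ s v (g ∸ R)) ⟩
  (s ^ℚ R * u ^ℚ R) * (s ^ℚ (g ∸ R) * v ^ℚ (g ∸ R))
    ≡⟨ solve 4 (λ a b c d → (a :* b) :* (c :* d) := (a :* c) :* (b :* d)) refl
             (s ^ℚ R) (u ^ℚ R) (s ^ℚ (g ∸ R)) (v ^ℚ (g ∸ R)) ⟩
  (s ^ℚ R * s ^ℚ (g ∸ R)) * monomial u v R g
    ≡⟨ cong (_* monomial u v R g) (trans (sym (^-+ s R (g ∸ R))) (cong (s ^ℚ_) (ℕ.m+[n∸m]≡n R≤g))) ⟩
  s ^ℚ g * monomial u v R g ∎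
  where open ≡-Reasoning; open ℚ-Solver.+-*-Solver

module _ {δ : Fun n} {p q : ℚ} (χ : SingletonCharacter δ p q) where
  open SingletonCharacter χ

  power-suc : ∀ k N c →
    (∀ A → A ⊆ ground N → ∣ A ∣ ≡ 1 → δ (restrict N A) * (δ ^⋆ k) (contract N A) ≡ c) →
    (δ ^⋆ suc k) N ≡ fromℕ ∣ ground N ∣ * c
  power-suc k N c on-singletons =
    trans (Σ-subsetsOf (ground N) term) (Σ-supported-on-singletons (ground N) term c term-off on-singletons)
    where
    term : Subset n → ℚ
    term A = δ (restrict N A) * (δ ^⋆ k) (contract N A)
    term-off : ∀ A → A ⊆ ground N → ∣ A ∣ ≢ 1 → term A ≡ 0ℚ
    term-off A _ ∣A∣≢1 = trans (cong (_* (δ ^⋆ k) (contract N A)) (off-singletons (restrict N A) ∣A∣≢1))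
                               (ℚ.*-zeroˡ ((δ ^⋆ k) (contract N A)))

  power-off : ∀ k N → ∣ ground N ∣ ≢ k → (δ ^⋆ k) N ≡ 0ℚ
  power-off zero    N ∣G∣≢0   = if-no (∣ ground N ∣ ≟ 0) ∣G∣≢0
  power-off (suc k) N ∣G∣≢1+k = trans (power-suc k N 0ℚ term-zero) (ℚ.*-zeroʳ (fromℕ ∣ ground N ∣))
    where
    term-zero : ∀ A → A ⊆ ground N → ∣ A ∣ ≡ 1 → δ (restrict N A) * (δ ^⋆ k) (contract N A) ≡ 0ℚ
    term-zero A A⊆G ∣A∣≡1 = trans (cong (δ (restrict N A) *_) (power-off k (contract N A) ∣G∖A∣≢k))
                                  (ℚ.*-zeroʳ (δ (restrict N A)))
      where
      ∣G∖A∣≢k : ∣ ground N ∖ A ∣ ≢ k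
      ∣G∖A∣≢k eq = ∣G∣≢1+k (trans (card-∖-singleton A⊆G ∣A∣≡1) (cong suc eq))

  module _ (M : Matroid n) where

    -- Peeling one element off a minor N: δ(N|A) · w(N/A) = w(N) for |A| = 1,
    -- since A is a coloop (rank drops by one) or a loop (rank unchanged).
    weight-peel : ∀ {N A} → MinorOf M N → A ⊆ ground N → ∣ A ∣ ≡ 1 →
      δ (restrict N A) * weight p q (contract N A) ≡ weight p q N
    weight-peel {N} {A} N-minor A⊆G ∣A∣≡1 = peel (n≤1⇒n≡0∨n≡1 r[A]≤1)
      where
      open ≡-Reasoning
      G : Subset n
      G = ground N
      R g′ R′ : ℕ
      R = rk N G
      g′ = ∣ G ∖ A ∣
      R′ = rk (contract N A) (G ∖ A)
      ∣G∣≡1+g′ : ∣ G ∣ ≡ suc g′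
      ∣G∣≡1+g′ = card-∖-singleton A⊆G ∣A∣≡1
      r[A]≤1 : rk N A ≤ 1
      r[A]≤1 = subst (rk N A ≤_) ∣A∣≡1 (minor-rank≤card M N-minor A⊆G)
      R′≡R∸r[A] : R′ ≡ R ∸ rk N A
      R′≡R∸r[A] = contract-rank-ground M N-minor A⊆G
      peel : rk N A ≡ 0 ⊎ rk N A ≡ 1 → δ (restrict N A) * monomial p q R′ g′ ≡ weight p q N
      peel (inj₂ r[A]≡1) = begin
        δ (restrict N A) * monomial p q R′ g′  ≡⟨ cong (_* monomial p q R′ g′) (on-coloop (restrict N A) ∣A∣≡1 r[A]≡1) ⟩
        p * monomial p q R′ g′                 ≡⟨ monomial-coloop p q R′ g′ ⟩
        monomial p q (suc R′) (suc g′)         ≡⟨ cong₂ (monomial p q) 1+R′≡R (sym ∣G∣≡1+g′) ⟩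
        weight p q N                           ∎
        where
        1≤R : 1 ≤ R
        1≤R = subst (_≤ R) r[A]≡1 (minor-mono M N-minor A⊆G (λ x∈G → x∈G))
        1+R′≡R : suc R′ ≡ R
        1+R′≡R = trans (cong suc (trans R′≡R∸r[A] (cong (R ∸_) r[A]≡1))) (ℕ.m+[n∸m]≡n 1≤R)
      peel (inj₁ r[A]≡0) = begin
        δ (restrict N A) * monomial p q R′ g′  ≡⟨ cong (_* monomial p q R′ g′) (on-loop (restrict N A) ∣A∣≡1 r[A]≡0) ⟩
        q * monomial p q R′ g′                 ≡⟨ monomial-loop p q R′≤g′ ⟩
        monomial p q R′ (suc g′)               ≡⟨ cong₂ (monomial p q) R′≡R (sym ∣G∣≡1+g′) ⟩
        weight p q N                           ∎
        where
        R′≡R : R′ ≡ R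
        R′≡R = trans R′≡R∸r[A] (cong (R ∸_) r[A]≡0)
        R′≤g′ : R′ ≤ g′
        R′≤g′ = minor-rank≤card M (contract-minor M N-minor A⊆G) (λ x∈ → x∈)

    power-on : ∀ k N → MinorOf M N → ∣ ground N ∣ ≡ k → (δ ^⋆ k) N ≡ fromℕ (k !) * weight p q N
    power-on zero N N-minor ∣G∣≡0 = begin
      ε N                  ≡⟨ if-yes (∣ ground N ∣ ≟ 0) ∣G∣≡0 ⟩
      1ℚ                   ≡⟨ cong₂ (λ R g → fromℕ 1 * monomial p q R g) (sym R≡0) (sym ∣G∣≡0) ⟩
      fromℕ 1 * weight p q N ∎
      where
      open ≡-Reasoning
      R≡0 : rk N (ground N) ≡ 0
      R≡0 = ℕ.n≤0⇒n≡0 (subst (rk N (ground N) ≤_) ∣G∣≡0 (minor-rank≤card M N-minor (λ x∈ → x∈)))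
    power-on (suc k) N N-minor ∣G∣≡1+k = begin
      (δ ^⋆ suc k) N                                 ≡⟨ power-suc k N (fromℕ (k !) * weight p q N) term ⟩
      fromℕ ∣ ground N ∣ * (fromℕ (k !) * weight p q N) ≡⟨ sym (ℚ.*-assoc (fromℕ ∣ ground N ∣) (fromℕ (k !)) (weight p q N)) ⟩
      fromℕ ∣ ground N ∣ * fromℕ (k !) * weight p q N  ≡⟨ cong (λ m → fromℕ m * fromℕ (k !) * weight p q N) ∣G∣≡1+k ⟩
      fromℕ (suc k) * fromℕ (k !) * weight p q N       ≡⟨ cong (_* weight p q N) (sym (fromℕ-* (suc k) (k !))) ⟩
      fromℕ (suc k !) * weight p q N                   ∎
      where
      open ≡-Reasoning
      term : ∀ A → A ⊆ ground N → ∣ A ∣ ≡ 1 →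
        δ (restrict N A) * (δ ^⋆ k) (contract N A) ≡ fromℕ (k !) * weight p q N
      term A A⊆G ∣A∣≡1 = begin
        δ (restrict N A) * (δ ^⋆ k) (contract N A)
          ≡⟨ cong (δ (restrict N A) *_) (power-on k (contract N A) (contract-minor M N-minor A⊆G) ∣G∖A∣≡k) ⟩
        δ (restrict N A) * (fromℕ (k !) * weight p q (contract N A))
          ≡⟨ solve 3 (λ d f w → d :* (f :* w) := f :* (d :* w)) refl (δ (restrict N A)) (fromℕ (k !)) (weight p q (contract N A)) ⟩
        fromℕ (k !) * (δ (restrict N A) * weight p q (contract N A))
          ≡⟨ cong (fromℕ (k !) *_) (weight-peel N-minor A⊆G ∣A∣≡1) ⟩
        fromℕ (k !) * weight p q N ∎
        where
        open ℚ-Solver.+-*-Solver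
        ∣G∖A∣≡k : ∣ ground N ∖ A ∣ ≡ k
        ∣G∖A∣≡k = suc-injective (trans (sym (card-∖-singleton A⊆G ∣A∣≡1)) ∣G∣≡1+k)

    -- Hence the exponential series collapses to its |G|-th term: exp_⋆ δ = weight.
    exp-weight : ∀ N → MinorOf M N → expStar δ N ≡ weight p q N
    exp-weight N N-minor = begin
      expStar δ N                           ≡⟨ Σ-range-select n g term g≤n term-off ⟩
      (δ ^⋆ g) N * 1/ g !                   ≡⟨ cong (_* 1/ g !) (power-on g N N-minor refl) ⟩
      fromℕ (g !) * weight p q N * 1/ g !   ≡⟨ solve 3 (λ f w i → f :* w :* i := w :* (f :* i)) refl (fromℕ (g !)) (weight p q N) (1/ g !) ⟩
      weight p q N * (fromℕ (g !) * 1/ g !) ≡⟨ cong (weight p q N *_) (fromℕ-inverse (g !) {{g !≢0}}) ⟩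
      weight p q N * 1ℚ                     ≡⟨ ℚ.*-identityʳ (weight p q N) ⟩
      weight p q N                          ∎
      where
      open ≡-Reasoning
      open ℚ-Solver.+-*-Solver
      g : ℕ
      g = ∣ ground N ∣
      1/_! : ℕ → ℚ
      1/ k ! = ((ℤ.+ 1) / (k !)) {{k !≢0}}
      term : ℕ → ℚ
      term k = (δ ^⋆ k) N * 1/ k !
      g≤n : g ≤ n
      g≤n = ∣p∣≤n (ground N)
      term-off : ∀ k → k ≢ g → term k ≡ 0ℚ
      term-off k k≢g = trans (cong (_* 1/ k !) (power-off k N (k≢g ∘ sym))) (ℚ.*-zeroˡ (1/ k !))

δcoloop-character : SingletonCharacter {n} δcoloop 1ℚ 0ℚ
δcoloop-character = record
  { off-singletons = λ N ∣G∣≢1 → if-no (one-element N ×-dec rank-is N 1) (∣G∣≢1 ∘ proj₁)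
  ; on-coloop      = λ N ∣G∣≡1 R≡1 → if-yes (one-element N ×-dec rank-is N 1) (∣G∣≡1 , R≡1)
  ; on-loop        = λ N _ R≡0 → if-no (one-element N ×-dec rank-is N 1) (ℕ.0≢1+n ∘ trans (sym R≡0) ∘ proj₂)
  }

δloop-character : SingletonCharacter {n} δloop 0ℚ 1ℚ
δloop-character = record
  { off-singletons = λ N ∣G∣≢1 → if-no (one-element N ×-dec rank-is N 0) (∣G∣≢1 ∘ proj₁)
  ; on-coloop      = λ N _ R≡1 → if-no (one-element N ×-dec rank-is N 0) (λ (_ , R≡0) → ℕ.0≢1+n (trans (sym R≡0) R≡1))
  ; on-loop        = λ N ∣G∣≡1 R≡0 → if-yes (one-element N ×-dec rank-is N 0) (∣G∣≡1 , R≡0)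
  }

⊕-character : ∀ {δ δ′ : Fun n} {p q p′ q′} → SingletonCharacter δ p q → SingletonCharacter δ′ p′ q′ →
  SingletonCharacter (δ ⊕F δ′) (p + p′) (q + q′)
⊕-character χ χ′ = record
  { off-singletons = λ N ∣G∣≢1 → cong₂ _+_ (off-singletons χ N ∣G∣≢1) (off-singletons χ′ N ∣G∣≢1)
  ; on-coloop      = λ N ∣G∣≡1 R≡1 → cong₂ _+_ (on-coloop χ N ∣G∣≡1 R≡1) (on-coloop χ′ N ∣G∣≡1 R≡1)
  ; on-loop        = λ N ∣G∣≡1 R≡0 → cong₂ _+_ (on-loop χ N ∣G∣≡1 R≡0) (on-loop χ′ N ∣G∣≡1 R≡0)
  }
  where open SingletonCharacter

·-character : ∀ c {δ : Fun n} {p q} → SingletonCharacter δ p q → SingletonCharacter (c ·F δ) (c * p) (c * q)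
·-character c χ = record
  { off-singletons = λ N ∣G∣≢1 → trans (cong (c *_) (off-singletons χ N ∣G∣≢1)) (ℚ.*-zeroʳ c)
  ; on-coloop      = λ N ∣G∣≡1 R≡1 → cong (c *_) (on-coloop χ N ∣G∣≡1 R≡1)
  ; on-loop        = λ N ∣G∣≡1 R≡0 → cong (c *_) (on-loop χ N ∣G∣≡1 R≡0)
  }
  where open SingletonCharacter

δ₁ δ₂ : ℚ → ℚ → Fun n
δ₁ y s = s ·F (δcoloop ⊕F ((y - 1ℚ) ·F δloop))
δ₂ x s = s ·F (((x - 1ℚ) ·F δcoloop) ⊕F δloop)

δ₁-character : ∀ y s → SingletonCharacter {n} (δ₁ y s) (s * 1ℚ) (s * (y - 1ℚ))
δ₁-character y s = subst₂ (SingletonCharacter (δ₁ y s)) (cong (s *_) coloop-value) (cong (s *_) loop-value)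
  (·-character s (⊕-character δcoloop-character (·-character (y - 1ℚ) δloop-character)))
  where
  open ℚ-Solver.+-*-Solver
  coloop-value : 1ℚ + (y - 1ℚ) * 0ℚ ≡ 1ℚ
  coloop-value = solve 1 (λ z → con 1ℚ :+ z :* con 0ℚ := con 1ℚ) refl (y - 1ℚ)
  loop-value : 0ℚ + (y - 1ℚ) * 1ℚ ≡ y - 1ℚ
  loop-value = solve 1 (λ z → con 0ℚ :+ z :* con 1ℚ := z) refl (y - 1ℚ)

δ₂-character : ∀ x s → SingletonCharacter {n} (δ₂ x s) (s * (x - 1ℚ)) (s * 1ℚ)
δ₂-character x s = subst₂ (SingletonCharacter (δ₂ x s)) (cong (s *_) coloop-value) (cong (s *_) loop-value)
  (·-character s (⊕-character (·-character (x - 1ℚ) δcoloop-character) δloop-character))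
  where
  open ℚ-Solver.+-*-Solver
  coloop-value : (x - 1ℚ) * 1ℚ + 0ℚ ≡ x - 1ℚ
  coloop-value = solve 1 (λ z → z :* con 1ℚ :+ con 0ℚ := z) refl (x - 1ℚ)
  loop-value : (x - 1ℚ) * 0ℚ + 1ℚ ≡ 1ℚ
  loop-value = solve 1 (λ z → z :* con 0ℚ :+ con 1ℚ := con 1ℚ) refl (x - 1ℚ)

tutte-term : Matroid n → ℚ → ℚ → Subset n → ℚ
tutte-term M x y A = ((x - 1ℚ) ^ℚ (rank M ⊤ ∸ rank M A)) * ((y - 1ℚ) ^ℚ (∣ A ∣ ∸ rank M A))

α-summand : ∀ (M : Matroid n) x y s A →
  expStar (δ₁ y s) (restrict (toMinor M) A) * expStar (δ₂ x s) (contract (toMinor M) A)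
    ≡ s ^ℚ n * tutte-term M x y A
α-summand {n} M x y s A = begin
  expStar (δ₁ y s) M|A * expStar (δ₂ x s) M/A
    ≡⟨ cong₂ _*_ (exp-weight (δ₁-character y s) M M|A M|A-minor) (exp-weight (δ₂-character x s) M M/A M/A-minor) ⟩
  weight (s * 1ℚ) (s * (y - 1ℚ)) M|A * weight (s * (x - 1ℚ)) (s * 1ℚ) M/A
    ≡⟨ cong₂ _*_ (monomial-scale s 1ℚ (y - 1ℚ) r[A]≤∣A∣) (monomial-scale s (x - 1ℚ) 1ℚ R′≤c) ⟩
  s ^ℚ ∣ A ∣ * (1ℚ ^ℚ rank M A * Y) * (s ^ℚ c * (X * 1ℚ ^ℚ (c ∸ R′)))
    ≡⟨ cong₂ (λ u v → s ^ℚ ∣ A ∣ * (u * Y) * (s ^ℚ c * (X * v))) (1^ (rank M A)) (1^ (c ∸ R′)) ⟩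
  s ^ℚ ∣ A ∣ * (1ℚ * Y) * (s ^ℚ c * (X * 1ℚ))
    ≡⟨ solve 4 (λ a b X Y → a :* (con 1ℚ :* Y) :* (b :* (X :* con 1ℚ)) := (a :* b) :* (X :* Y)) refl
             (s ^ℚ ∣ A ∣) (s ^ℚ c) X Y ⟩
  s ^ℚ ∣ A ∣ * s ^ℚ c * (X * Y)
    ≡⟨ cong₂ (λ m R → m * ((x - 1ℚ) ^ℚ R * Y)) s^∣A∣+c≡s^n R′≡r⊤∸r[A] ⟩
  s ^ℚ n * tutte-term M x y A ∎
  where
  open ≡-Reasoning
  open ℚ-Solver.+-*-Solver
  M-minor : MinorOf M (toMinor M)
  M-minor = toMinor-minor M
  M|A M/A : Minor n
  M|A = restrict (toMinor M) A
  M/A = contract (toMinor M) A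
  M|A-minor : MinorOf M M|A
  M|A-minor = restrict-minor M M-minor ⊆⊤
  M/A-minor : MinorOf M M/A
  M/A-minor = contract-minor M M-minor ⊆⊤
  c R′ : ℕ
  c = ∣ ⊤ ∖ A ∣
  R′ = rk M/A (⊤ ∖ A)
  X Y : ℚ
  X = (x - 1ℚ) ^ℚ R′
  Y = (y - 1ℚ) ^ℚ (∣ A ∣ ∸ rank M A)
  r[A]≤∣A∣ : rank M A ≤ ∣ A ∣
  r[A]≤∣A∣ = minor-rank≤card M M-minor ⊆⊤
  R′≤c : R′ ≤ c
  R′≤c = minor-rank≤card M M/A-minor (λ x∈ → x∈)
  R′≡r⊤∸r[A] : R′ ≡ rank M ⊤ ∸ rank M A
  R′≡r⊤∸r[A] = contract-rank-ground M M-minor ⊆⊤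
  s^∣A∣+c≡s^n : s ^ℚ ∣ A ∣ * s ^ℚ c ≡ s ^ℚ n
  s^∣A∣+c≡s^n = trans (sym (^-+ s ∣ A ∣ c)) (cong (s ^ℚ_) (trans (sym (card-∖ {G = ⊤} {D = A} ⊆⊤)) (∣⊤∣≡n n)))

mainTheorem3 : (n : ℕ) (M : Matroid n) (x y s : ℚ) →
    α x y s M ≡ (s ^ℚ n) * tutte M x y
mainTheorem3 n M x y s = begin
  α x y s M
    ≡⟨ cong (λ As → Σℚ As summand) (filter-all (_⊆? ⊤) (universal {P = _⊆ ⊤} (λ _ → ⊆⊤) (subsets n))) ⟩
  Σℚ (subsets n) summand
    ≡⟨ Σ-cong (subsets n) (α-summand M x y s) ⟩
  Σℚ (subsets n) (λ A → s ^ℚ n * tutte-term M x y A)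
    ≡⟨ sym (Σ-*ˡ (s ^ℚ n) (subsets n) (tutte-term M x y)) ⟩
  s ^ℚ n * tutte M x y ∎
  where
  open ≡-Reasoning
  summand : Subset n → ℚ
  summand A = expStar (δ₁ y s) (restrict (toMinor M) A) * expStar (δ₂ x s) (contract (toMinor M) A)
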